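{- Let $\mathcal{V}$ be a quantaloid and $(f_i:\mathbb{A}_i\to\mathbb{B}_i)_{i\in I}$ a family of $\mathcal{V}$-functors each belonging to $\mathbb{O}\mathrm{d}$. Then their sum $\coprod_{i\in I}f_i:\coprod_{i\in I}\mathbb{A}_i\to\coprod_{i\in I}\mathbb{B}_i$, sending $x\in\mathrm{Obj}(\mathbb{A}_i)$ to $f_i(x)$, belongs to $\mathbb{O}\mathrm{d}$.
   Context: A quantaloid $\mathcal{V}$ is a small, locally ordered bicategory whose hom-posets are complete lattices and which is biclosed (for every arrow $f$, $-\otimes f$ and $f\otimes -$ have right adjoints, $\otimes$ = horizontal composition in diagrammatic order). A $\mathcal{V}$-category $\mathbb{A}$: a set $\mathrm{Obj}(\mathbb{A})$, a map $a\mapsto a_+\in\mathrm{Obj}(\mathcal{V})$, arrows $\mathbb{A}(a,b):a_+\to b_+$ with $id_{a_+}\le\mathbb{A}(a,a)$, $\mathbb{A}(a,b)\otimes\mathbb{A}(b,c)\le\mathbb{A}(a,c)$. A $\mathcal{V}$-functor $f:\mathbb{A}\to\mathbb{B}$: a map on objects with $(fa)_+=a_+$ and $\mathbb{A}(a,a')\le\mathbb{B}(fa,fa')$. The coproduct $\coprod_{i\in I}\mathbb{A}_i$ has as objects the disjoint union of the $\mathrm{Obj}(\mathbb{A}_i)$, with hom $\mathbb{A}_i(x,y)$ if $x,y$ both lie in $\mathbb{A}_i$ and the bottom element of $\mathcal{V}(x_+,y_+)$ otherwise. A functional bisimulation is a $\mathcal{V}$-functor $f:\mathbb{A}\to\mathbb{B}$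 with $\mathbb{B}(f(a),b)=\bigvee_{a':f(a')=b}\mathbb{A}(a,a')$ for all $a,b$; $\mathbb{O}\mathrm{d}$ is the class of functional bisimulations surjective on objects. -}

module Defs where

open import Level using (Level; _⊔_; suc)
open import Data.Product using (Σ; ∃; _×_; _,_; proj₁; proj₂)
open import Relation.Binary.PropositionalEquality using (_≡_; refl; sym; trans; cong)
open import Relation.Binary.Structures using (IsPartialOrder)
open import Function using (_⇔_)

-- Composition _⊗_ is written in diagrammatic order: f : x → y, g : y → z
-- gives f ⊗ g : x → z.

record Quantaloid (o h r ℓ : Level) : Set (suc (o ⊔ h ⊔ r ⊔ ℓ)) where
  infixl 7 _⊗_
  infix 4 _≤_
  field
    Obj  : Set o
    Hom  : Obj → Obj → Set h
    _≤_  : ∀ {x y} → Hom x y → Hom x y → Set r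
    ≤-isPartialOrder : ∀ {x y} → IsPartialOrder (_≡_ {A = Hom x y}) _≤_
    ⋁      : ∀ {x y} {J : Set ℓ} → (J → Hom x y) → Hom x y
    ⋁-ub   : ∀ {x y} {J : Set ℓ} (φ : J → Hom x y) (j : J) → φ j ≤ ⋁ φ
    ⋁-least : ∀ {x y} {J : Set ℓ} (φ : J → Hom x y) (u : Hom x y) →
              (∀ j → φ j ≤ u) → ⋁ φ ≤ u
    id   : ∀ x → Hom x x
    _⊗_  : ∀ {x y z} → Hom x y → Hom y z → Hom x z
    ⊗-assoc : ∀ {w x y z} (f : Hom w x) (g : Hom x y) (k : Hom y z) →
              (f ⊗ g) ⊗ k ≡ f ⊗ (g ⊗ k)
    ⊗-idˡ : ∀ {x y} (f : Hom x y) → id x ⊗ f ≡ f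
    ⊗-idʳ : ∀ {x y} (f : Hom x y) → f ⊗ id y ≡ f
    ⊗-mono : ∀ {x y z} {f f' : Hom x y} {g g' : Hom y z} →
             f ≤ f' → g ≤ g' → f ⊗ g ≤ f' ⊗ g'
    _↙_ : ∀ {x y z} → Hom x z → Hom y z → Hom x y
    ↙-adj : ∀ {x y z} (g : Hom x y) (f : Hom y z) (k : Hom x z) →
            (g ⊗ f ≤ k) ⇔ (g ≤ k ↙ f)
    _↘_ : ∀ {x y z} → Hom x y → Hom x z → Hom y z
    ↘-adj : ∀ {x y z} (f : Hom x y) (g : Hom y z) (k : Hom x z) →
            (f ⊗ g ≤ k) ⇔ (g ≤ f ↘ k)

module _ {o h r ℓ} (V : Quantaloid o h r ℓ) where
  open Quantaloid V

  cast : ∀ {x x' y y'} → x ≡ x' → y ≡ y' → Hom x y → Hom x' y'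
  cast refl refl f = f

  record VCatData : Set (suc ℓ ⊔ o ⊔ h) where
    field
      Ob  : Set ℓ
      _₊  : Ob → Obj
      hom : (a b : Ob) → Hom (a ₊) (b ₊)

  open VCatData public

  IsVCat : VCatData → Set (ℓ ⊔ r)
  IsVCat A =
    (∀ a → id (_₊ A a) ≤ hom A a a) ×
    (∀ a b c → hom A a b ⊗ hom A b c ≤ hom A a c)

  VCat : Set (suc ℓ ⊔ o ⊔ h ⊔ r)
  VCat = Σ VCatData IsVCat

  record VMap (A B : VCatData) : Set (ℓ ⊔ o) where
    field
      fun  : Ob A → Ob B
      pres : ∀ a → _₊ B (fun a) ≡ _₊ A a

  open VMap public

  IsVFunctor : ∀ {A B} → VMap A B → Set (ℓ ⊔ r)
  IsVFunctor {A} {B} f =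
    ∀ a a' → hom A a a' ≤ cast (pres f a) (pres f a') (hom B (fun f a) (fun f a'))

  -- functional bisimulation: a V-functor with
  --   B(f a, b) = ⋁_{a' : f a' = b} A(a, a')
  IsFunctionalBisim : ∀ {A B} → VMap A B → Set (ℓ ⊔ r ⊔ h)
  IsFunctionalBisim {A} {B} f =
    IsVFunctor f ×
    (∀ a b → hom B (fun f a) b ≡
       ⋁ {J = Σ (Ob A) (λ a' → fun f a' ≡ b)}
         (λ { (a' , e) → cast (sym (pres f a)) (trans (sym (pres f a')) (cong (_₊ B) e))
                              (hom A a a') }))

  SurjectiveOnObjects : ∀ {A B} → VMap A B → Set ℓ
  SurjectiveOnObjects {A} {B} f = ∀ b → ∃ λ a → fun f a ≡ b

  InOd : ∀ {A B} → VMap A B → Set (ℓ ⊔ r ⊔ h)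
  InOd f = IsFunctionalBisim f × SurjectiveOnObjects f

  module _ {I : Set ℓ} (A : I → VCatData) where

    homΣ : ∀ {i j} → i ≡ j → (x : Ob (A i)) (y : Ob (A j)) →
           Hom (_₊ (A i) x) (_₊ (A j) y)
    homΣ {i} refl x y = hom (A i) x y

    -- hom((i,x),(j,y)) = A_i(x,y) if i = j, and ⊥ otherwise,
    -- expressed (constructively) as the join over proofs of i = j.
    ∐ : VCatData
    ∐ = record
      { Ob  = Σ I (λ i → Ob (A i))
      ; _₊  = λ { (i , x) → _₊ (A i) x }
      ; hom = λ { (i , x) (j , y) → ⋁ {J = i ≡ j} (λ e → homΣ e x y) }
      }

  ∐map : ∀ {I : Set ℓ} {A B : I → VCatData} →
         (∀ i → VMap (A i) (B i)) → VMap (∐ A) (∐ B)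
  ∐map f = record
    { fun  = λ { (i , x) → i , fun (f i) x }
    ; pres = λ { (i , x) → pres (f i) x }
    }

{-# OPTIONS --safe #-}
-- The hom of a coproduct between objects of different summands is the empty
-- join, and the fibre of ∐ f over a point of 𝔹ᵢ lies entirely in 𝔸ᵢ, so the
-- functor inequality and the bisimulation equation for ∐ f reduce summand by
-- summand to those for the fᵢ.  Moreover, for every V-functor the join over
-- a fibre is automatically below the hom, so of the bisimulation equation only
-- the inequality  𝔹(f a, b) ≤ ⋁ 𝔸(a, a')  needs an argument.
module Submission where

open import Defs
open import Data.Product using (Σ; _,_; proj₁; proj₂)
open import Function using (_∘_)
open import Relation.Binary.Bundles using (Poset)
open import Relation.Binary.PropositionalEquality using (_≡_; refl; sym; trans; cong)
open import Relation.Binary.PropositionalEquality.Properties using (trans-reflʳ)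
import Relation.Binary.Reasoning.PartialOrder as PosetReasoning

module _ {o h r ℓ} (V : Quantaloid o h r ℓ) where
  open Quantaloid V

  homPoset : Obj → Obj → Poset h h r
  homPoset x y = record { isPartialOrder = ≤-isPartialOrder {x} {y} }

  module ≤-Reasoning {x y : Obj} = PosetReasoning (homPoset x y)
  open ≤-Reasoning using (begin_; step-≤; step-≡; _∎)

  ≤-trans : ∀ {x y} {u v w : Hom x y} → u ≤ v → v ≤ w → u ≤ w
  ≤-trans {x} {y} = Poset.trans (homPoset x y)

  ≤-reflexive : ∀ {x y} {u v : Hom x y} → u ≡ v → u ≤ v
  ≤-reflexive {x} {y} = Poset.reflexive (homPoset x y)

  ≤-antisym : ∀ {x y} {u v : Hom x y} → u ≤ v → v ≤ u → u ≡ v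
  ≤-antisym {x} {y} = Poset.antisym (homPoset x y)

  cast-mono : ∀ {x x' y y'} (p : x ≡ x') (q : y ≡ y') {u v : Hom x y} →
              u ≤ v → cast V p q u ≤ cast V p q v
  cast-mono refl refl u≤v = u≤v

  cast-transpose : ∀ {x x' y y'} (p : x ≡ x') (q : y ≡ y') {u : Hom x' y'} {v : Hom x y} →
                   u ≤ cast V p q v → cast V (sym p) (sym q) u ≤ v
  cast-transpose refl refl u≤v = u≤v

  fibreJoin : ∀ {A B} (f : VMap V A B) (a : Ob A) (b : Ob B) → Hom (_₊ B (fun f a)) (_₊ B b)
  fibreJoin {A} {B} f a b = ⋁ {J = Σ (Ob A) (λ a' → fun f a' ≡ b)} λ (a' , e) →
    cast V (sym (pres f a)) (trans (sym (pres f a')) (cong (_₊ B) e)) (hom A a a')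

  fibreJoin≤hom : ∀ {A B} (f : VMap V A B) → IsVFunctor V f →
                  ∀ a b → fibreJoin f a b ≤ hom B (fun f a) b
  fibreJoin≤hom {A} {B} f isF a b = ⋁-least _ _ λ { (a' , refl) → summand≤ a' }
    where
    summand≤ : ∀ a' → cast V (sym (pres f a)) (trans (sym (pres f a')) refl) (hom A a a')
                      ≤ hom B (fun f a) (fun f a')
    summand≤ a' rewrite trans-reflʳ (sym (pres f a')) =
      cast-transpose (pres f a) (pres f a') (isF a a')

  isFunctionalBisim-≤ : ∀ {A B} (f : VMap V A B) → IsVFunctor V f →
                        (∀ a b → hom B (fun f a) b ≤ fibreJoin f a b) → IsFunctionalBisim V f
  isFunctionalBisim-≤ f isF hom≤ = isF , λ a b → ≤-antisym (hom≤ a b) (fibreJoin≤hom f isF a b)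

  ∐-hom-component : ∀ {I : Set ℓ} (A : I → VCatData V) i {x y} →
                    hom (A i) x y ≤ hom (∐ V A) (i , x) (i , y)
  ∐-hom-component A i = ⋁-ub _ refl

  module _ {I : Set ℓ} {A B : I → VCatData V} (f : ∀ i → VMap V (A i) (B i)) where

    ∐map-isVFunctor : (∀ i → IsVFunctor V (f i)) → IsVFunctor V (∐map V f)
    ∐map-isVFunctor isF (i , x) (j , y) = ⋁-least _ _ λ { refl →
      ≤-trans (isF i x y) (cast-mono (pres (f i) x) (pres (f i) y) (∐-hom-component B i)) }

    fibreJoin≤∐map-fibreJoin : ∀ i x y → fibreJoin (f i) x y ≤ fibreJoin (∐map V f) (i , x) (i , y)
    fibreJoin≤∐map-fibreJoin i x y = ⋁-least _ _ λ { (x' , refl) →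
      ≤-trans (cast-mono _ _ (∐-hom-component A i)) (⋁-ub _ ((i , x') , refl)) }

    ∐map-hom≤fibreJoin : (∀ i a b → hom (B i) (fun (f i) a) b ≤ fibreJoin (f i) a b) →
                         ∀ a b → hom (∐ V B) (fun (∐map V f) a) b ≤ fibreJoin (∐map V f) a b
    ∐map-hom≤fibreJoin hom≤ (i , x) (j , y) = ⋁-least _ _ λ { refl → begin
      hom (B i) (fun (f i) x) y          ≤⟨ hom≤ i x y ⟩
      fibreJoin (f i) x y                ≤⟨ fibreJoin≤∐map-fibreJoin i x y ⟩
      fibreJoin (∐map V f) (i , x) (i , y) ∎ }

    ∐map-isFunctionalBisim : (∀ i → IsFunctionalBisim V (f i)) → IsFunctionalBisim V (∐map V f)
    ∐map-isFunctionalBisim bisim =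
      isFunctionalBisim-≤ (∐map V f) (∐map-isVFunctor (proj₁ ∘ bisim))
        (∐map-hom≤fibreJoin λ i a b → ≤-reflexive (proj₂ (bisim i) a b))

    ∐map-surjective : (∀ i → SurjectiveOnObjects V (f i)) → SurjectiveOnObjects V (∐map V f)
    ∐map-surjective surj (j , y) = let x , fx≡y = surj j y in (j , x) , cong (j ,_) fx≡y

    ∐map-inOd : (∀ i → InOd V (f i)) → InOd V (∐map V f)
    ∐map-inOd od = ∐map-isFunctionalBisim (proj₁ ∘ od) , ∐map-surjective (proj₂ ∘ od)

mainTheorem11 : ∀ {o h r ℓ} (V : Quantaloid o h r ℓ) (I : Set ℓ)
                  (A B : I → VCat V) (f : ∀ i → VMap V (proj₁ (A i)) (proj₁ (B i))) →
                  (∀ i → InOd V (f i)) →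
                  InOd V (∐map V {I} {λ i → proj₁ (A i)} {λ i → proj₁ (B i)} f)
mainTheorem11 V I A B f = ∐map-inOd V f
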